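{- Let $\kappa_1\in\mathbb Z_{\ge2}$, $\delta_2,\delta_3\in\{0,1\}$ with $\delta_2\ge\delta_3$, and $\lambda=(\kappa_1,\delta_2-\delta_3,\delta_3)$. With the elements $w_0,w_p,w_{p,r},w_{pr},w_{p,rt}\in V_\lambda$ defined in the context (according to the parity of $\kappa_1$ and whether $\delta_2=\delta_3$): (a) If $\kappa_1$ is even and $(\delta_2,\delta_3)=(0,0)$, then $w=w_0$ satisfies $\tau_\lambda(E^{\mathfrak k}_{1,3})w=\tau_\lambda(E^{\mathfrak k}_{2,4})w=0$ and $\tau_\lambda(m_i)w=w$ ($0\le i\le3$). (b) If $\kappa_1$ is odd and $(\delta_2,\delta_3)=(0,0)$, then $w=w_2+\sqrt{ -1}w_4$ satisfies $\tau_\lambda(E^{\mathfrak k}_{1,3})w=0$, $\tau_\lambda(E^{\mathfrak k}_{2,4})w=\sqrt{ -1}w$, $\tau_\lambda(m_i)w=w$ for $i=0,1$ and $\tau_\lambda(m_i)w=-\overline w$ for $i=2,3$, where $\overline w=w_2-\sqrt{ -1}w_4$. (c) If $\kappa_1$ is even and $(\delta_2,\delta_3)=(1,1)$, then $w=E^{\mathfrak p}_{1,2}\otimes w_{3,4}-E^{\mathfrak p}_{2,3}\otimes w_{1,4}+E^{\mathfrak p}_{3,4}\otimes w_{1,2}-E^{\mathfrak p}_{1,4}\otimes w_{2,3}\in\mathfrak p_{\mathbb C}\otimes V_\lambda$ satisfies $(\mathrm{ad}\otimes\tau_\lambda)(E^{\mathfrak k}_{1,3})w=(\mathrm{ad}\otimes\tau_\lambda)(E^{\mathfrak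 k}_{2,4})w=0$ and $(\mathrm{Ad}\otimes\tau_\lambda)(m_i)w=w$ ($0\le i\le3$). (d) If $\kappa_1$ is odd and $(\delta_2,\delta_3)=(1,1)$, then $w=(-E^{\mathfrak p}_{3,4}+\sqrt{ -1}E^{\mathfrak p}_{2,3})\otimes w_1+(E^{\mathfrak p}_{1,4}-\sqrt{ -1}E^{\mathfrak p}_{1,2})\otimes w_3$ satisfies $(\mathrm{ad}\otimes\tau_\lambda)(E^{\mathfrak k}_{1,3})w=0$, $(\mathrm{ad}\otimes\tau_\lambda)(E^{\mathfrak k}_{2,4})w=\sqrt{ -1}w$, $(\mathrm{Ad}\otimes\tau_\lambda)(m_i)w=w$ for $i=0,1$ and $=-\overline w$ for $i=2,3$, where $\overline w=(-E^{\mathfrak p}_{3,4}-\sqrt{ -1}E^{\mathfrak p}_{2,3})\otimes w_1+(E^{\mathfrak p}_{1,4}+\sqrt{ -1}E^{\mathfrak p}_{1,2})\otimes w_3$. (e) If $\kappa_1$ is even and $(\delta_2,\delta_3)=(1,0)$, then $w=-\sqrt{ -1}w_{2,24}+w_{4,24}$ satisfies $\tau_\lambda(E^{\mathfrak k}_{1,3})w=0$, $\tau_\lambda(E^{\mathfrak k}_{2,4})w=\sqrt{ -1}w$, $\tau_\lambda(m_i)w=w$ for $i=0,1$ and $=-\overline w$ for $i=2,3$, where $\overline w=\sqrt{ -1}w_{2,24}+w_{4,24}$. (f) If $\kappa_1$ is odd and $(\delta_2,\delta_3)=(1,0)$, then $w=E^{\mathfrak p}_{1,2}\otimes w_{12}-E^{\mathfrak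 p}_{2,3}\otimes w_{23}+E^{\mathfrak p}_{3,4}\otimes w_{34}+E^{\mathfrak p}_{1,4}\otimes w_{14}$ satisfies $(\mathrm{ad}\otimes\tau_\lambda)(E^{\mathfrak k}_{1,3})w=(\mathrm{ad}\otimes\tau_\lambda)(E^{\mathfrak k}_{2,4})w=0$ and $(\mathrm{Ad}\otimes\tau_\lambda)(m_i)w=w$ ($0\le i\le3$).
   Context: $K=\mathrm O(4)$ with Lie algebra $\mathfrak k$; $\mathfrak p$ is the space of real symmetric $4\times4$ matrices, $\mathfrak p_{\mathbb C}$ its complexification, on which $K$ acts by $\mathrm{Ad}$ and $\mathfrak k$ by $\mathrm{ad}$; on $\mathfrak p_{\mathbb C}\otimes V_\lambda$ these act diagonally. $E_{i,j}$ are matrix units, $E^{\mathfrak k}_{i,j}=E_{i,j}-E_{j,i}$, $E^{\mathfrak p}_{i,j}=E_{i,j}+E_{j,i}$. $m_0=1_4$, $m_1=\mathrm{diag}(-1,1,1,1)$, $m_2=\mathrm{diag}(1,-1,1,1)$, $m_3=m_1m_2$. $K$-types: $V_{st}=\mathbb C^4$ with basis $\xi_1..\xi_4$, $K$ acting by multiplication, $\xi_{ij}=\xi_i\wedge\xi_j$; $\mathcal R=\mathrm{Sym}(V_{st})\otimes\mathrm{Sym}(\wedge^2V_{st})$ (commutative algebra with induced $K$-action), $\mathcal R_{(\lambda_1,\lambda_2)}=\mathrm{Sym}^{\lambda_1-\lambda_2}(V_{st})\otimes\mathrm{Sym}^{\lambda_2}(\wedge^2V_{st})$; $I_{\mathcal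 R}$ the ideal generated by $\sum_k\xi_k^2$, $\xi_{12}\xi_{34}-\xi_{13}\xi_{24}+\xi_{14}\xi_{23}$, $\sum_k\xi_k\xi_{ik}$, $\sum_k\xi_{ik}\xi_{jk}$ ($i\le j$), $\xi_i\xi_{jk}-\xi_j\xi_{ik}+\xi_k\xi_{ij}$ ($i<j<k$); $q_{\mathcal R}$ the quotient map; $V_\lambda=q_{\mathcal R}(\mathcal R_{(\lambda_1,\lambda_2)})$ with $\tau_\lambda(k)=(\det k)^{\lambda_3}\cdot$(induced action), and $\tau_\lambda$ also denotes its differential. With $\xi=\xi_1^2+\xi_3^2\in\mathcal R$ and $1\le p,r,t\le4$: for $\kappa_1$ even and $\delta_2=\delta_3$, $w_0=q_{\mathcal R}(\xi^{\kappa_1/2})$, $w_{p,r}=q_{\mathcal R}(\xi^{(\kappa_1-2)/2}\xi_p\xi_r)$; for $\kappa_1$ even and $(\delta_2,\delta_3)=(1,0)$, $w_{p,rt}=q_{\mathcal R}(\xi^{(\kappa_1-2)/2}\xi_p\xi_{rt})$; for $\kappa_1$ odd and $\delta_2=\delta_3$, $w_p=q_{\mathcal R}(\xi^{(\kappa_1-1)/2}\xi_p)$; for $\kappa_1$ odd and $(\delta_2,\delta_3)=(1,0)$, $w_{pr}=q_{\mathcal R}(\xi^{(\kappa_1-1)/2}\xi_{pr})$. -}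

module Defs where

open import Data.Nat as ℕ using (ℕ; zero; suc)
open import Data.Fin as Fin using (Fin; zero; suc; toℕ; punchIn)
open import Data.Rational as ℚ using (ℚ; 0ℚ; 1ℚ)
open import Data.Product using (_×_; _,_; proj₂)
open import Data.Bool using (if_then_else_; _∧_)
open import Relation.Nullary.Decidable using (⌊_⌋)

-- Gaussian rationals ℚ(√-1) ⊂ ℂ (all scalars occurring are in here)

record ℚi : Set where
  constructor _+i_
  field
    re : ℚ
    im : ℚ
infix 5 _+i_
open ℚi public

0i 1i -1i 𝕚 : ℚi
0i = 0ℚ +i 0ℚ
1i = 1ℚ +i 0ℚ
-1i = (ℚ.- 1ℚ) +i 0ℚ
𝕚 = 0ℚ +i 1ℚ

_+ᵢ_ : ℚi → ℚi → ℚi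
(a +i b) +ᵢ (c +i d) = (a ℚ.+ c) +i (b ℚ.+ d)

_*ᵢ_ : ℚi → ℚi → ℚi
(a +i b) *ᵢ (c +i d) = ((a ℚ.* c) ℚ.- (b ℚ.* d)) +i ((a ℚ.* d) ℚ.+ (b ℚ.* c))

-ᵢ_ : ℚi → ℚi
-ᵢ x = -1i *ᵢ x

_^ᵢ_ : ℚi → ℕ → ℚi
x ^ᵢ zero = 1i
x ^ᵢ suc n = x *ᵢ (x ^ᵢ n)

fromℕᵢ : ℕ → ℚi
fromℕᵢ zero = 0i
fromℕᵢ (suc n) = 1i +ᵢ fromℕᵢ n

sumᵢ : ∀ {n} → (Fin n → ℚi) → ℚi
sumᵢ {zero} f = 0i
sumᵢ {suc n} f = f zero +ᵢ sumᵢ (λ j → f (suc j))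

-- matrices (indices 0..3 stand for the paper's 1..4)

i₁ i₂ i₃ i₄ : Fin 4
i₁ = zero
i₂ = suc zero
i₃ = suc (suc zero)
i₄ = suc (suc (suc zero))

Mat : Set
Mat = Fin 4 → Fin 4 → ℚi

E : Fin 4 → Fin 4 → Mat
E i j a b = if ⌊ a Fin.≟ i ⌋ ∧ ⌊ b Fin.≟ j ⌋ then 1i else 0i

_+ₘ_ : Mat → Mat → Mat
(X +ₘ Y) a b = X a b +ᵢ Y a b

_·ₘ_ : ℚi → Mat → Mat
(c ·ₘ X) a b = c *ᵢ X a b

-ₘ_ : Mat → Mat
-ₘ X = -1i ·ₘ X

Ek : Fin 4 → Fin 4 → Mat
Ek i j = E i j +ₘ (-ₘ E j i)

Ep : Fin 4 → Fin 4 → Mat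
Ep i j = E i j +ₘ E j i

diag : (Fin 4 → ℚi) → Mat
diag d a b = if ⌊ a Fin.≟ b ⌋ then d a else 0i

m : Fin 4 → Mat
m zero = diag (λ _ → 1i)
m (suc zero) = diag (λ { zero → -1i ; _ → 1i })
m (suc (suc zero)) = diag (λ { (suc zero) → -1i ; _ → 1i })
m (suc (suc (suc zero))) = diag (λ { zero → -1i ; (suc zero) → -1i ; _ → 1i })

det : ∀ {n} → (Fin n → Fin n → ℚi) → ℚi
det {zero} M = 1i
det {suc n} M = sumᵢ (λ j → ((-1i ^ᵢ toℕ j) *ᵢ M zero j)
                    *ᵢ det (λ a b → M (suc a) (punchIn j b)))

trace : Mat → ℚi
trace X = sumᵢ (λ a → X a a)

-- the algebra ℛ = Sym(V_st) ⊗ Sym(∧² V_st) over ℚ(√-1), as syntax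

-- basis ξ_{ij} (i<j) of ∧² V_st
data Pair : Set where
  p12 p13 p14 p23 p24 p34 : Pair

pairIdx : Pair → Fin 4 × Fin 4
pairIdx p12 = i₁ , i₂
pairIdx p13 = i₁ , i₃
pairIdx p14 = i₁ , i₄
pairIdx p23 = i₂ , i₃
pairIdx p24 = i₂ , i₄
pairIdx p34 = i₃ , i₄

data Gen : Set where
  x : Fin 4 → Gen
  y : Pair → Gen

infixl 6 _⊕_
infixl 7 _⊛_
infixl 6 _⊖_
infixr 7 _·ₑ_
infixl 5 _⊞_
infixr 6 _⊗_
infix 6 ⊟_
infixr 7 _·ₚ_
infixl 6 _+ₘ_
infixr 7 _·ₘ_
infix 8 -ₘ_
infix 8 -ᵢ_

data Expr : Set where
  gen : Gen → Expr
  con : ℚi → Expr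
  _⊕_ : Expr → Expr → Expr
  _⊛_ : Expr → Expr → Expr

neg : Expr → Expr
neg e = con -1i ⊛ e

_⊖_ : Expr → Expr → Expr
e ⊖ f = e ⊕ neg f

sumE : ∀ {n} → (Fin n → Expr) → Expr
sumE {zero} f = con 0i
sumE {suc n} f = f zero ⊕ sumE (λ j → f (suc j))

_^ₑ_ : Expr → ℕ → Expr
e ^ₑ zero = con 1i
e ^ₑ suc n = e ⊛ (e ^ₑ n)

ξ₁ : Fin 4 → Expr
ξ₁ i = gen (x i)

-- ξ_{ij} = ξ_i ∧ ξ_j for arbitrary i, j (ξ_{ii} = 0, ξ_{ji} = -ξ_{ij})
ξ₂ : Fin 4 → Fin 4 → Expr
ξ₂ zero zero = con 0i
ξ₂ zero (suc zero) = gen (y p12)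
ξ₂ zero (suc (suc zero)) = gen (y p13)
ξ₂ zero (suc (suc (suc zero))) = gen (y p14)
ξ₂ (suc zero) zero = neg (gen (y p12))
ξ₂ (suc zero) (suc zero) = con 0i
ξ₂ (suc zero) (suc (suc zero)) = gen (y p23)
ξ₂ (suc zero) (suc (suc (suc zero))) = gen (y p24)
ξ₂ (suc (suc zero)) zero = neg (gen (y p13))
ξ₂ (suc (suc zero)) (suc zero) = neg (gen (y p23))
ξ₂ (suc (suc zero)) (suc (suc zero)) = con 0i
ξ₂ (suc (suc zero)) (suc (suc (suc zero))) = gen (y p34)
ξ₂ (suc (suc (suc zero))) zero = neg (gen (y p14))
ξ₂ (suc (suc (suc zero))) (suc zero) = neg (gen (y p24))
ξ₂ (suc (suc (suc zero))) (suc (suc zero)) = neg (gen (y p34))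
ξ₂ (suc (suc (suc zero))) (suc (suc (suc zero))) = con 0i

data IdealGen : Expr → Set where
  g-sq   : IdealGen (sumE (λ k → ξ₁ k ⊛ ξ₁ k))
  g-pl   : IdealGen (ξ₂ i₁ i₂ ⊛ ξ₂ i₃ i₄ ⊖ ξ₂ i₁ i₃ ⊛ ξ₂ i₂ i₄ ⊕ ξ₂ i₁ i₄ ⊛ ξ₂ i₂ i₃)
  g-mix  : (i : Fin 4) → IdealGen (sumE (λ k → ξ₁ k ⊛ ξ₂ i k))
  g-quad : (i j : Fin 4) → toℕ i ℕ.≤ toℕ j →
           IdealGen (sumE (λ k → ξ₂ i k ⊛ ξ₂ j k))
  g-tri  : (i j k : Fin 4) → toℕ i ℕ.< toℕ j → toℕ j ℕ.< toℕ k →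
           IdealGen (ξ₁ i ⊛ ξ₂ j k ⊖ ξ₁ j ⊛ ξ₂ i k ⊕ ξ₁ k ⊛ ξ₂ i j)

-- equality in ℛ / I_ℛ: the congruence generated by the commutative
-- ℚ(√-1)-algebra laws and  g ≈ 0  for every ideal generator g.
infix 4 _≈_
data _≈_ : Expr → Expr → Set where
  ≈-refl  : ∀ {a} → a ≈ a
  ≈-sym   : ∀ {a b} → a ≈ b → b ≈ a
  ≈-trans : ∀ {a b c} → a ≈ b → b ≈ c → a ≈ c
  ⊕-cong  : ∀ {a b c d} → a ≈ b → c ≈ d → a ⊕ c ≈ b ⊕ d
  ⊛-cong  : ∀ {a b c d} → a ≈ b → c ≈ d → a ⊛ c ≈ b ⊛ d
  ⊕-assoc : ∀ a b c → (a ⊕ b) ⊕ c ≈ a ⊕ (b ⊕ c)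
  ⊕-comm  : ∀ a b → a ⊕ b ≈ b ⊕ a
  ⊕-idˡ   : ∀ a → con 0i ⊕ a ≈ a
  ⊕-invʳ  : ∀ a → a ⊕ neg a ≈ con 0i
  ⊛-assoc : ∀ a b c → (a ⊛ b) ⊛ c ≈ a ⊛ (b ⊛ c)
  ⊛-comm  : ∀ a b → a ⊛ b ≈ b ⊛ a
  ⊛-idˡ   : ∀ a → con 1i ⊛ a ≈ a
  distribʳ : ∀ a b c → (a ⊕ b) ⊛ c ≈ a ⊛ c ⊕ b ⊛ c
  con-+   : ∀ p q → con p ⊕ con q ≈ con (p +ᵢ q)
  con-*   : ∀ p q → con p ⊛ con q ≈ con (p *ᵢ q)
  ideal   : ∀ {g} → IdealGen g → g ≈ con 0i

substE : (Gen → Expr) → Expr → Expr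
substE σ (gen g) = σ g
substE σ (con c) = con c
substE σ (a ⊕ b) = substE σ a ⊕ substE σ b
substE σ (a ⊛ b) = substE σ a ⊛ substE σ b

actGen : Mat → Gen → Expr
actGen k (x j) = sumE (λ l → con (k l j) ⊛ ξ₁ l)
actGen k (y p) with pairIdx p
... | (i , j) = sumE (λ l → sumE (λ n → con (k l i *ᵢ k n j) ⊛ ξ₂ l n))

derGen : Mat → Gen → Expr
derGen X (x j) = sumE (λ l → con (X l j) ⊛ ξ₁ l)
derGen X (y p) with pairIdx p
... | (i , j) = sumE (λ l → con (X l i) ⊛ ξ₂ l j)
              ⊕ sumE (λ l → con (X l j) ⊛ ξ₂ i l)

derE : Mat → Expr → Expr
derE X (gen g) = derGen X g
derE X (con c) = con 0i
derE X (a ⊕ b) = derE X a ⊕ derE X b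
derE X (a ⊛ b) = derE X a ⊛ b ⊕ a ⊛ derE X b

Weight : Set
Weight = ℕ × ℕ × ℕ

λ₃ : Weight → ℕ
λ₃ (_ , _ , l) = l

τ : Weight → Mat → Expr → Expr
τ Λ k e = con (det k ^ᵢ λ₃ Λ) ⊛ substE (actGen k) e

-- differential τ_λ(X) (the det^{λ₃} factor contributes λ₃ tr X, = 0 on 𝔨)
dτ : Weight → Mat → Expr → Expr
dτ Λ X e = derE X e ⊕ con (fromℕᵢ (λ₃ Λ) *ᵢ trace X) ⊛ e

-- 𝔭_ℂ ⊗ V_λ, realised as 4×4 matrices with entries in V_λ
-- (X ⊗ v  ↦  (X_{ab} v)_{ab})

PV : Set
PV = Fin 4 → Fin 4 → Expr

_⊗_ : Mat → Expr → PV
(X ⊗ v) a b = con (X a b) ⊛ v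

_⊞_ : PV → PV → PV
(W ⊞ W') a b = W a b ⊕ W' a b

⊟_ : PV → PV
(⊟ W) a b = neg (W a b)

infix 4 _≈ₚ_
_≈ₚ_ : PV → PV → Set
W ≈ₚ W' = ∀ a b → W a b ≈ W' a b

-- (Ad ⊗ τ_λ)(k): X ⊗ v ↦ k X k⁻¹ ⊗ τ_λ(k) v, with k⁻¹ = kᵀ for k ∈ O(4)
Adτ : Weight → Mat → PV → PV
Adτ Λ k W a b = sumE (λ c → sumE (λ d →
                  con (k a c) ⊛ τ Λ k (W c d) ⊛ con (k b d)))

adτ : Weight → Mat → PV → PV
adτ Λ Y W a b = sumE (λ c → con (Y a c) ⊛ W c b ⊖ W a c ⊛ con (Y c b))
                ⊕ dτ Λ Y (W a b)

wt : ℕ → ℕ → ℕ → Weight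
wt κ₁ δ₂ δ₃ = κ₁ , δ₂ ℕ.∸ δ₃ , δ₃

ξ : Expr
ξ = ξ₁ i₁ ⊛ ξ₁ i₁ ⊕ ξ₁ i₃ ⊛ ξ₁ i₃

w₀ : ℕ → Expr
w₀ κ₁ = ξ ^ₑ (κ₁ ℕ./ 2)

w[_,_] : ℕ → Fin 4 → Fin 4 → Expr
w[ κ₁ , p ] r = ξ ^ₑ ((κ₁ ℕ.∸ 2) ℕ./ 2) ⊛ ξ₁ p ⊛ ξ₁ r

w[_,_,_] : ℕ → Fin 4 → Fin 4 → Fin 4 → Expr
w[ κ₁ , p , r ] t = ξ ^ₑ ((κ₁ ℕ.∸ 2) ℕ./ 2) ⊛ ξ₁ p ⊛ ξ₂ r t

w₁[_] : ℕ → Fin 4 → Expr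
w₁[ κ₁ ] p = ξ ^ₑ ((κ₁ ℕ.∸ 1) ℕ./ 2) ⊛ ξ₁ p

w₂[_] : ℕ → Fin 4 → Fin 4 → Expr
w₂[ κ₁ ] p r = ξ ^ₑ ((κ₁ ℕ.∸ 1) ℕ./ 2) ⊛ ξ₂ p r

_·ₑ_ : ℚi → Expr → Expr
c ·ₑ e = con c ⊛ e

m₀ m₁ m₂ m₃ : Mat
m₀ = m zero
m₁ = m (suc zero)
m₂ = m (suc (suc zero))
m₃ = m (suc (suc (suc zero)))

𝟘 : Expr
𝟘 = con 0i

𝟘ₚ : PV
𝟘ₚ a b = 𝟘

_·ₚ_ : ℚi → PV → PV
(c ·ₚ W) a b = con c ⊛ W a b

{-# OPTIONS --safe #-}
-- Every vector in question is a polynomial in the generators ξ_i, ξ_{ij} times a power of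
-- ξ = ξ₁² + ξ₃².  That power is killed by E^𝔨₁₃ (ξ is a rotation invariant of the
-- (1,3)-plane) and by E^𝔨₂₄ (ξ does not involve ξ₂, ξ₄), and it is fixed by the sign
-- matrices m_i.  Treating it as an opaque indeterminate with these three properties, each
-- claimed identity becomes an identity between polynomials in eleven indeterminates which
-- holds already in ℛ, without the relations of I_ℛ, and is checked by normalising both sides
-- with the commutative ring solver.  In particular the hypotheses 2 ≤ κ₁ and on the parity
-- of κ₁ only select the vector: the identities hold for every power of ξ.
module Submission where

open import Defs
open import Data.Nat using (ℕ; _≤_; _%_)
open import Data.Fin using (Fin)
open import Data.Product using (_×_)
open import Relation.Binary.PropositionalEquality using (_≡_)

open import Data.Nat using (zero; suc; _∸_; _/_)
open import Data.Fin using (zero; suc; #_)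
-- With _,_ in scope the mixfix names w[_,_] and w[_,_,_] of Defs would parse ambiguously.
open import Data.Product using () renaming (_,_ to _&_)
open import Data.Vec using (Vec; []; _∷_; lookup; tabulate)
open import Data.Vec.Properties using (lookup∘tabulate)
open import Data.Maybe using (Maybe; just; nothing)
open import Function using (_∘_)
open import Relation.Nullary using (yes)
open import Relation.Binary.PropositionalEquality using (refl; sym; trans; cong; cong₂)
open import Relation.Binary.Bundles using (Setoid)
open import Relation.Binary.Structures using (IsEquivalence)
open import Algebra.Bundles using (CommutativeRing; RawRing)
open import Algebra.Solver.Ring.AlmostCommutativeRing
  using (fromCommutativeRing; _-Raw-AlmostCommutative⟶_)
import Algebra.Consequences.Setoid
import Algebra.Solver.Ring
import Relation.Binary.Reasoning.Setoid
import Data.Rational.Properties as ℚ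

≈-isEquivalence : IsEquivalence _≈_
≈-isEquivalence = record { refl = ≈-refl ; sym = ≈-sym ; trans = ≈-trans }

≈-setoid : Setoid _ _
≈-setoid = record { isEquivalence = ≈-isEquivalence }

open Setoid ≈-setoid using () renaming (reflexive to ≈-reflexive)
open Algebra.Consequences.Setoid ≈-setoid using (comm∧idˡ⇒id; comm∧invʳ⇒inv; comm∧distrʳ⇒distr)

commutativeRing : CommutativeRing _ _
commutativeRing = record
  { Carrier = Expr ; _≈_ = _≈_ ; _+_ = _⊕_ ; _*_ = _⊛_ ; -_ = neg ; 0# = 𝟘 ; 1# = con 1i
  ; isCommutativeRing = record
    { isRing = record
      { +-isAbelianGroup = record
        { isGroup = record
          { isMonoid = record
            { isSemigroup = record
              { isMagma = record { isEquivalence = ≈-isEquivalence ; ∙-cong = ⊕-cong }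
              ; assoc = ⊕-assoc }
            ; identity = comm∧idˡ⇒id ⊕-comm ⊕-idˡ }
          ; inverse = comm∧invʳ⇒inv ⊕-comm ⊕-invʳ
          ; ⁻¹-cong = ⊛-cong ≈-refl }
        ; comm = ⊕-comm }
      ; *-cong = ⊛-cong
      ; *-assoc = ⊛-assoc
      ; *-identity = comm∧idˡ⇒id ⊛-comm ⊛-idˡ
      ; distrib = comm∧distrʳ⇒distr ⊕-cong ⊛-comm (λ c a b → distribʳ a b c) }
    ; *-comm = ⊛-comm } }

open CommutativeRing commutativeRing using (zeroˡ; zeroʳ; +-identityˡ)

ℚi-rawRing : RawRing _ _
ℚi-rawRing = record
  { Carrier = ℚi ; _≈_ = _≡_ ; _+_ = _+ᵢ_ ; _*_ = _*ᵢ_ ; -_ = -ᵢ_ ; 0# = 0i ; 1# = 1i }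

con-homomorphism : ℚi-rawRing -Raw-AlmostCommutative⟶ fromCommutativeRing commutativeRing
con-homomorphism = record
  { ⟦_⟧ = con
  ; +-homo = λ p q → ≈-sym (con-+ p q)
  ; *-homo = λ p q → ≈-sym (con-* p q)
  ; -‿homo = λ p → ≈-sym (con-* -1i p)
  ; 0-homo = ≈-refl
  ; 1-homo = ≈-refl }

con-≟ : (p q : ℚi) → Maybe (con p ≈ con q)
con-≟ (a +i b) (c +i d) with a ℚ.≟ c | b ℚ.≟ d
... | yes a≡c | yes b≡d = just (≈-reflexive (cong con (cong₂ _+i_ a≡c b≡d)))
... | _       | _       = nothing

module Solver = Algebra.Solver.Ring ℚi-rawRing (fromCommutativeRing commutativeRing)
                  con-homomorphism con-≟

-- Polynomials with one opaque factor

data Term : Set where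
  atom : Term
  gen  : Gen → Term
  con  : ℚi → Term
  _⊕_  : Term → Term → Term
  _⊛_  : Term → Term → Term

infixl 6 _⊕_
infixl 7 _⊛_

⟦_⟧[_] : Term → Expr → Expr
⟦ atom  ⟧[ A ] = A
⟦ gen g ⟧[ A ] = gen g
⟦ con c ⟧[ A ] = con c
⟦ s ⊕ t ⟧[ A ] = ⟦ s ⟧[ A ] ⊕ ⟦ t ⟧[ A ]
⟦ s ⊛ t ⟧[ A ] = ⟦ s ⟧[ A ] ⊛ ⟦ t ⟧[ A ]

⌜_⌝ : Expr → Term
⌜ gen g ⌝ = gen g
⌜ con c ⌝ = con c
⌜ e ⊕ f ⌝ = ⌜ e ⌝ ⊕ ⌜ f ⌝
⌜ e ⊛ f ⌝ = ⌜ e ⌝ ⊛ ⌜ f ⌝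

⟦⌜_⌝⟧ : ∀ e {A} → ⟦ ⌜ e ⌝ ⟧[ A ] ≡ e
⟦⌜ gen g ⌝⟧ = refl
⟦⌜ con c ⌝⟧ = refl
⟦⌜ e ⊕ f ⌝⟧ = cong₂ _⊕_ ⟦⌜ e ⌝⟧ ⟦⌜ f ⌝⟧
⟦⌜ e ⊛ f ⌝⟧ = cong₂ _⊛_ ⟦⌜ e ⌝⟧ ⟦⌜ f ⌝⟧

genIndex : Gen → Fin 10
genIndex (x zero)                   = # 0
genIndex (x (suc zero))             = # 1
genIndex (x (suc (suc zero)))       = # 2
genIndex (x (suc (suc (suc zero)))) = # 3
genIndex (y p12) = # 4
genIndex (y p13) = # 5
genIndex (y p14) = # 6
genIndex (y p23) = # 7
genIndex (y p24) = # 8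
genIndex (y p34) = # 9

generators : Vec Expr 10
generators = gen (x i₁) ∷ gen (x i₂) ∷ gen (x i₃) ∷ gen (x i₄)
           ∷ gen (y p12) ∷ gen (y p13) ∷ gen (y p14) ∷ gen (y p23) ∷ gen (y p24) ∷ gen (y p34) ∷ []

lookup-generators : ∀ g → lookup generators (genIndex g) ≡ gen g
lookup-generators (x zero)                   = refl
lookup-generators (x (suc zero))             = refl
lookup-generators (x (suc (suc zero)))       = refl
lookup-generators (x (suc (suc (suc zero)))) = refl
lookup-generators (y p12) = refl
lookup-generators (y p13) = refl
lookup-generators (y p14) = refl
lookup-generators (y p23) = refl
lookup-generators (y p24) = refl
lookup-generators (y p34) = refl

toPolynomial : Term → Solver.Polynomial 11
toPolynomial atom    = Solver.var zero
toPolynomial (gen g) = Solver.var (suc (genIndex g))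
toPolynomial (con c) = Solver.con c
toPolynomial (s ⊕ t) = toPolynomial s Solver.:+ toPolynomial t
toPolynomial (s ⊛ t) = toPolynomial s Solver.:* toPolynomial t

toPolynomial-correct : ∀ t A → Solver.⟦ toPolynomial t ⟧ (A ∷ generators) ≈ ⟦ t ⟧[ A ]
toPolynomial-correct atom    A = ≈-refl
toPolynomial-correct (gen g) A = ≈-reflexive (lookup-generators g)
toPolynomial-correct (con c) A = ≈-refl
toPolynomial-correct (s ⊕ t) A = ⊕-cong (toPolynomial-correct s A) (toPolynomial-correct t A)
toPolynomial-correct (s ⊛ t) A = ⊛-cong (toPolynomial-correct s A) (toPolynomial-correct t A)

normalForm : Term → Expr → Expr
normalForm t A = Solver.⟦ toPolynomial t ⟧↓ (A ∷ generators)

normalForm-correct : ∀ t A → normalForm t A ≈ ⟦ t ⟧[ A ]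
normalForm-correct t A = ≈-trans (Solver.correct (toPolynomial t) _) (toPolynomial-correct t A)

-- Callers pass A explicitly: left to unification, it forces Agda to normalise polynomials
-- with symbolic coefficients.
≈-by-normalForm : ∀ s t {A} → normalForm s A ≡ normalForm t A → ⟦ s ⟧[ A ] ≈ ⟦ t ⟧[ A ]
≈-by-normalForm s t {A} eq =
  ≈-trans (≈-sym (normalForm-correct s A)) (≈-trans (≈-reflexive eq) (normalForm-correct t A))

derT : Mat → Term → Term
derT X atom    = con 0i
derT X (gen g) = ⌜ derGen X g ⌝
derT X (con c) = con 0i
derT X (s ⊕ t) = derT X s ⊕ derT X t
derT X (s ⊛ t) = derT X s ⊛ t ⊕ s ⊛ derT X t

derE-⟦⟧ : ∀ X {A} → derE X A ≈ 𝟘 → ∀ t → derE X ⟦ t ⟧[ A ] ≈ ⟦ derT X t ⟧[ A ]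
derE-⟦⟧ X A-const atom    = A-const
derE-⟦⟧ X A-const (gen g) = ≈-reflexive (sym ⟦⌜ derGen X g ⌝⟧)
derE-⟦⟧ X A-const (con c) = ≈-refl
derE-⟦⟧ X A-const (s ⊕ t) = ⊕-cong (derE-⟦⟧ X A-const s) (derE-⟦⟧ X A-const t)
derE-⟦⟧ X A-const (s ⊛ t) =
  ⊕-cong (⊛-cong (derE-⟦⟧ X A-const s) ≈-refl) (⊛-cong ≈-refl (derE-⟦⟧ X A-const t))

actT : Mat → Term → Term
actT k atom    = atom
actT k (gen g) = ⌜ actGen k g ⌝
actT k (con c) = con c
actT k (s ⊕ t) = actT k s ⊕ actT k t
actT k (s ⊛ t) = actT k s ⊛ actT k t

substE-⟦⟧ : ∀ k {A} → substE (actGen k) A ≈ A → ∀ t →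
          substE (actGen k) ⟦ t ⟧[ A ] ≈ ⟦ actT k t ⟧[ A ]
substE-⟦⟧ k A-fixed atom    = A-fixed
substE-⟦⟧ k A-fixed (gen g) = ≈-reflexive (sym ⟦⌜ actGen k g ⌝⟧)
substE-⟦⟧ k A-fixed (con c) = ≈-refl
substE-⟦⟧ k A-fixed (s ⊕ t) = ⊕-cong (substE-⟦⟧ k A-fixed s) (substE-⟦⟧ k A-fixed t)
substE-⟦⟧ k A-fixed (s ⊛ t) = ⊛-cong (substE-⟦⟧ k A-fixed s) (substE-⟦⟧ k A-fixed t)

dτT : Weight → Mat → Term → Term
dτT Λ X t = derT X t ⊕ con (fromℕᵢ (λ₃ Λ) *ᵢ trace X) ⊛ t

τT : Weight → Mat → Term → Term
τT Λ k t = con (det k ^ᵢ λ₃ Λ) ⊛ actT k t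

dτ-by-normalForm : ∀ Λ X {A} → derE X A ≈ 𝟘 → ∀ s t →
                   normalForm (dτT Λ X s) A ≡ normalForm t A → dτ Λ X ⟦ s ⟧[ A ] ≈ ⟦ t ⟧[ A ]
dτ-by-normalForm Λ X {A} A-const s t eq =
  ≈-trans (⊕-cong (derE-⟦⟧ X A-const s) ≈-refl) (≈-by-normalForm (dτT Λ X s) t {A} eq)

τ-by-normalForm : ∀ Λ k {A} → substE (actGen k) A ≈ A → ∀ s t →
                  normalForm (τT Λ k s) A ≡ normalForm t A → τ Λ k ⟦ s ⟧[ A ] ≈ ⟦ t ⟧[ A ]
τ-by-normalForm Λ k {A} A-fixed s t eq =
  ≈-trans (⊛-cong ≈-refl (substE-⟦⟧ k A-fixed s)) (≈-by-normalForm (τT Λ k s) t {A} eq)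

PT : Set
PT = Fin 4 → Fin 4 → Term

⟦_⟧ₚ[_] : PT → Expr → PV
⟦ W ⟧ₚ[ A ] a b = ⟦ W a b ⟧[ A ]

infixr 6 _⊗ₜ_
infixl 5 _⊞ₜ_
infix 6 ⊟ₜ_
infixr 7 _·ₜ_

_⊗ₜ_ : Mat → Term → PT
(X ⊗ₜ t) a b = con (X a b) ⊛ t

_⊞ₜ_ : PT → PT → PT
(V ⊞ₜ W) a b = V a b ⊕ W a b

⊟ₜ_ : PT → PT
(⊟ₜ W) a b = con -1i ⊛ W a b

_·ₜ_ : ℚi → PT → PT
(c ·ₜ W) a b = con c ⊛ W a b

𝟘ₜ : PT
𝟘ₜ a b = con 0i

sumT : ∀ {n} → (Fin n → Term) → Term
sumT {zero}  f = con 0i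
sumT {suc n} f = f zero ⊕ sumT (f ∘ suc)

adT : Weight → Mat → PT → PT
adT Λ Y W a b = sumT (λ c → con (Y a c) ⊛ W c b ⊕ con -1i ⊛ (W a c ⊛ con (Y c b)))
                ⊕ dτT Λ Y (W a b)

AdT : Weight → Mat → PT → PT
AdT Λ k W a b = sumT (λ c → sumT (λ d → con (k a c) ⊛ τT Λ k (W c d) ⊛ con (k b d)))

sumE-cong : ∀ {n} {f g : Fin n → Expr} → (∀ i → f i ≈ g i) → sumE f ≈ sumE g
sumE-cong {zero}  f≈g = ≈-refl
sumE-cong {suc n} f≈g = ⊕-cong (f≈g zero) (sumE-cong (f≈g ∘ suc))

tabulate-injective : ∀ {n} {A : Set} {f g : Fin n → A} → tabulate f ≡ tabulate g → ∀ i → f i ≡ g i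
tabulate-injective {f = f} {g} eq i =
  trans (sym (lookup∘tabulate f i)) (trans (cong (λ v → lookup v i) eq) (lookup∘tabulate g i))

tabulate²-injective : ∀ {m n} {A : Set} (f g : Fin m → Fin n → A) →
                      tabulate (tabulate ∘ f) ≡ tabulate (tabulate ∘ g) → ∀ i j → f i j ≡ g i j
tabulate²-injective f g eq i j = tabulate-injective (tabulate-injective {f = tabulate ∘ f} eq i) j

-- A single refl on this table checks all sixteen entries of a matrix identity.
NormalForms : PT → Expr → Vec (Vec Expr 4) 4
NormalForms W A = tabulate (tabulate ∘ λ a b → normalForm (W a b) A)

≈ₚ-by-normalForms : ∀ V W {A} → NormalForms V A ≡ NormalForms W A → ⟦ V ⟧ₚ[ A ] ≈ₚ ⟦ W ⟧ₚ[ A ]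
≈ₚ-by-normalForms V W {A} eq a b =
  ≈-by-normalForm (V a b) (W a b) {A}
  (tabulate²-injective (λ a b → normalForm (V a b) A) (λ a b → normalForm (W a b) A) eq a b)

adτ-by-normalForms : ∀ Λ Y {A} → derE Y A ≈ 𝟘 → ∀ V W →
                     NormalForms (adT Λ Y V) A ≡ NormalForms W A →
                     adτ Λ Y ⟦ V ⟧ₚ[ A ] ≈ₚ ⟦ W ⟧ₚ[ A ]
adτ-by-normalForms Λ Y {A} A-const V W eq a b =
  ≈-trans (⊕-cong ≈-refl (⊕-cong (derE-⟦⟧ Y A-const (V a b)) ≈-refl))
          (≈ₚ-by-normalForms (adT Λ Y V) W {A} eq a b)

Adτ-by-normalForms : ∀ Λ k {A} → substE (actGen k) A ≈ A → ∀ V W →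
                     NormalForms (AdT Λ k V) A ≡ NormalForms W A →
                     Adτ Λ k ⟦ V ⟧ₚ[ A ] ≈ₚ ⟦ W ⟧ₚ[ A ]
Adτ-by-normalForms Λ k {A} A-fixed V W eq a b =
  ≈-trans (sumE-cong λ c → sumE-cong (entry c)) (≈ₚ-by-normalForms (AdT Λ k V) W {A} eq a b)
  where
  entry : ∀ c d → con (k a c) ⊛ τ Λ k ⟦ V c d ⟧[ A ] ⊛ con (k b d)
                  ≈ ⟦ con (k a c) ⊛ τT Λ k (V c d) ⊛ con (k b d) ⟧[ A ]
  entry c d = ⊛-cong (⊛-cong ≈-refl (⊛-cong ≈-refl (substE-⟦⟧ k A-fixed (V c d)))) ≈-refl

record Invariant (A : Expr) : Set where
  field
    E₁₃-kills : derE (Ek i₁ i₃) A ≈ 𝟘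
    E₂₄-kills : derE (Ek i₂ i₄) A ≈ 𝟘
    m-fixes   : ∀ i → substE (actGen (m i)) A ≈ A

derE-^ₑ : ∀ X {e} → derE X e ≈ 𝟘 → ∀ n → derE X (e ^ₑ n) ≈ 𝟘
derE-^ₑ X e-const zero    = ≈-refl
derE-^ₑ X {e} e-const (suc n) = begin
  derE X e ⊛ e ^ₑ n ⊕ e ⊛ derE X (e ^ₑ n) ≈⟨ ⊕-cong (⊛-cong e-const ≈-refl)
                                                     (⊛-cong ≈-refl (derE-^ₑ X e-const n)) ⟩
  𝟘 ⊛ e ^ₑ n ⊕ e ⊛ 𝟘                     ≈⟨ ⊕-cong (zeroˡ _) (zeroʳ e) ⟩
  𝟘 ⊕ 𝟘                                   ≈⟨ +-identityˡ 𝟘 ⟩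
  𝟘                                       ∎
  where open Relation.Binary.Reasoning.Setoid ≈-setoid

substE-^ₑ : ∀ σ {e} → substE σ e ≈ e → ∀ n → substE σ (e ^ₑ n) ≈ e ^ₑ n
substE-^ₑ σ e-fixed zero    = ≈-refl
substE-^ₑ σ e-fixed (suc n) = ⊛-cong e-fixed (substE-^ₑ σ e-fixed n)

^ₑ-invariant : ∀ {e} → Invariant e → ∀ n → Invariant (e ^ₑ n)
^ₑ-invariant e-inv n = record
  { E₁₃-kills = derE-^ₑ (Ek i₁ i₃) E₁₃-kills n
  ; E₂₄-kills = derE-^ₑ (Ek i₂ i₄) E₂₄-kills n
  ; m-fixes   = λ i → substE-^ₑ (actGen (m i)) (m-fixes i) n }
  where open Invariant e-inv

ξ-invariant : Invariant ξ
ξ-invariant = record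
  { E₁₃-kills = kills (Ek i₁ i₃) refl
  ; E₂₄-kills = kills (Ek i₂ i₄) refl
  ; m-fixes   = λ { zero                   → fixes (m zero) refl
                  ; (suc zero)             → fixes (m (suc zero)) refl
                  ; (suc (suc zero))       → fixes (m (suc (suc zero))) refl
                  ; (suc (suc (suc zero))) → fixes (m (suc (suc (suc zero)))) refl } }
  where
  ξₜ : Term
  ξₜ = ⌜ ξ ⌝
  kills : ∀ X → normalForm (derT X ξₜ) 𝟘 ≡ normalForm (con 0i) 𝟘 → derE X ξ ≈ 𝟘
  kills X eq = ≈-trans (derE-⟦⟧ X {𝟘} ≈-refl ξₜ) (≈-by-normalForm (derT X ξₜ) (con 0i) {𝟘} eq)
  fixes : ∀ k → normalForm (actT k ξₜ) 𝟘 ≡ normalForm ξₜ 𝟘 → substE (actGen k) ξ ≈ ξ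
  fixes k eq = ≈-trans (substE-⟦⟧ k {𝟘} ≈-refl ξₜ) (≈-by-normalForm (actT k ξₜ) ξₜ {𝟘} eq)

Adτ-m-by-normalForms : ∀ Λ {A} → Invariant A → ∀ V →
                       tabulate (λ i → NormalForms (AdT Λ (m i) V) A)
                         ≡ tabulate (λ _ → NormalForms V A) →
                       ∀ i → Adτ Λ (m i) ⟦ V ⟧ₚ[ A ] ≈ₚ ⟦ V ⟧ₚ[ A ]
Adτ-m-by-normalForms Λ {A} A-inv V eq i =
  Adτ-by-normalForms Λ (m i) (Invariant.m-fixes A-inv i) V V
    (tabulate-injective {f = λ i → NormalForms (AdT Λ (m i) V) A} eq i)

ξₜ₁ : Fin 4 → Term
ξₜ₁ i = gen (x i)

ξₜ₂ : Fin 4 → Fin 4 → Term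
ξₜ₂ i j = ⌜ ξ₂ i j ⌝

lemma6p6a : ∀ κ₁ {A} → Invariant A →
            let Λ = wt κ₁ 0 0 in
            dτ Λ (Ek i₁ i₃) A ≈ 𝟘 × dτ Λ (Ek i₂ i₄) A ≈ 𝟘 × (∀ i → τ Λ (m i) A ≈ A)
lemma6p6a κ₁ A-inv =
    dτ-by-normalForm Λ (Ek i₁ i₃) E₁₃-kills atom (con 0i) refl
  & dτ-by-normalForm Λ (Ek i₂ i₄) E₂₄-kills atom (con 0i) refl
  & λ i → ≈-trans (⊛-idˡ _) (m-fixes i)
  where
  open Invariant A-inv
  Λ : Weight
  Λ = wt κ₁ 0 0

wᵇ w̄ᵇ : Term
wᵇ = atom ⊛ ξₜ₁ i₂ ⊕ con 𝕚 ⊛ (atom ⊛ ξₜ₁ i₄)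
w̄ᵇ = atom ⊛ ξₜ₁ i₂ ⊕ con -1i ⊛ (con 𝕚 ⊛ (atom ⊛ ξₜ₁ i₄))

lemma6p6b : ∀ κ₁ {A} → Invariant A →
            let Λ = wt κ₁ 0 0 ; w = ⟦ wᵇ ⟧[ A ] ; w̄ = ⟦ w̄ᵇ ⟧[ A ] in
            dτ Λ (Ek i₁ i₃) w ≈ 𝟘 × dτ Λ (Ek i₂ i₄) w ≈ 𝕚 ·ₑ w
            × τ Λ m₀ w ≈ w × τ Λ m₁ w ≈ w × τ Λ m₂ w ≈ neg w̄ × τ Λ m₃ w ≈ neg w̄
lemma6p6b κ₁ A-inv =
    dτ-by-normalForm Λ (Ek i₁ i₃) E₁₃-kills wᵇ (con 0i) refl
  & dτ-by-normalForm Λ (Ek i₂ i₄) E₂₄-kills wᵇ (con 𝕚 ⊛ wᵇ) refl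
  & τ-by-normalForm Λ m₀ (m-fixes (# 0)) wᵇ wᵇ refl
  & τ-by-normalForm Λ m₁ (m-fixes (# 1)) wᵇ wᵇ refl
  & τ-by-normalForm Λ m₂ (m-fixes (# 2)) wᵇ (con -1i ⊛ w̄ᵇ) refl
  & τ-by-normalForm Λ m₃ (m-fixes (# 3)) wᵇ (con -1i ⊛ w̄ᵇ) refl
  where
  open Invariant A-inv
  Λ : Weight
  Λ = wt κ₁ 0 0

Wᶜ : PT
Wᶜ = Ep i₁ i₂ ⊗ₜ atom ⊛ ξₜ₁ i₃ ⊛ ξₜ₁ i₄ ⊞ₜ ⊟ₜ (Ep i₂ i₃ ⊗ₜ atom ⊛ ξₜ₁ i₁ ⊛ ξₜ₁ i₄)
     ⊞ₜ Ep i₃ i₄ ⊗ₜ atom ⊛ ξₜ₁ i₁ ⊛ ξₜ₁ i₂ ⊞ₜ ⊟ₜ (Ep i₁ i₄ ⊗ₜ atom ⊛ ξₜ₁ i₂ ⊛ ξₜ₁ i₃)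

lemma6p6c : ∀ κ₁ {A} → Invariant A →
            let Λ = wt κ₁ 1 1 ; w = ⟦ Wᶜ ⟧ₚ[ A ] in
            adτ Λ (Ek i₁ i₃) w ≈ₚ 𝟘ₚ × adτ Λ (Ek i₂ i₄) w ≈ₚ 𝟘ₚ × (∀ i → Adτ Λ (m i) w ≈ₚ w)
lemma6p6c κ₁ A-inv =
    adτ-by-normalForms Λ (Ek i₁ i₃) E₁₃-kills Wᶜ 𝟘ₜ refl
  & adτ-by-normalForms Λ (Ek i₂ i₄) E₂₄-kills Wᶜ 𝟘ₜ refl
  & Adτ-m-by-normalForms Λ A-inv Wᶜ refl
  where
  open Invariant A-inv
  Λ : Weight
  Λ = wt κ₁ 1 1

Wᵈ W̄ᵈ : PT
Wᵈ = ((-ₘ Ep i₃ i₄) +ₘ (𝕚 ·ₘ Ep i₂ i₃)) ⊗ₜ atom ⊛ ξₜ₁ i₁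
     ⊞ₜ (Ep i₁ i₄ +ₘ ((-ᵢ 𝕚) ·ₘ Ep i₁ i₂)) ⊗ₜ atom ⊛ ξₜ₁ i₃
W̄ᵈ = ((-ₘ Ep i₃ i₄) +ₘ ((-ᵢ 𝕚) ·ₘ Ep i₂ i₃)) ⊗ₜ atom ⊛ ξₜ₁ i₁
     ⊞ₜ (Ep i₁ i₄ +ₘ (𝕚 ·ₘ Ep i₁ i₂)) ⊗ₜ atom ⊛ ξₜ₁ i₃

lemma6p6d : ∀ κ₁ {A} → Invariant A →
            let Λ = wt κ₁ 1 1 ; w = ⟦ Wᵈ ⟧ₚ[ A ] ; w̄ = ⟦ W̄ᵈ ⟧ₚ[ A ] in
            adτ Λ (Ek i₁ i₃) w ≈ₚ 𝟘ₚ × adτ Λ (Ek i₂ i₄) w ≈ₚ 𝕚 ·ₚ w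
            × Adτ Λ m₀ w ≈ₚ w × Adτ Λ m₁ w ≈ₚ w × Adτ Λ m₂ w ≈ₚ ⊟ w̄ × Adτ Λ m₃ w ≈ₚ ⊟ w̄
lemma6p6d κ₁ A-inv =
    adτ-by-normalForms Λ (Ek i₁ i₃) E₁₃-kills Wᵈ 𝟘ₜ refl
  & adτ-by-normalForms Λ (Ek i₂ i₄) E₂₄-kills Wᵈ (𝕚 ·ₜ Wᵈ) refl
  & Adτ-by-normalForms Λ m₀ (m-fixes (# 0)) Wᵈ Wᵈ refl
  & Adτ-by-normalForms Λ m₁ (m-fixes (# 1)) Wᵈ Wᵈ refl
  & Adτ-by-normalForms Λ m₂ (m-fixes (# 2)) Wᵈ (⊟ₜ W̄ᵈ) refl
  & Adτ-by-normalForms Λ m₃ (m-fixes (# 3)) Wᵈ (⊟ₜ W̄ᵈ) refl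
  where
  open Invariant A-inv
  Λ : Weight
  Λ = wt κ₁ 1 1

wᵉ w̄ᵉ : Term
wᵉ = con (-ᵢ 𝕚) ⊛ (atom ⊛ ξₜ₁ i₂ ⊛ ξₜ₂ i₂ i₄) ⊕ atom ⊛ ξₜ₁ i₄ ⊛ ξₜ₂ i₂ i₄
w̄ᵉ = con 𝕚 ⊛ (atom ⊛ ξₜ₁ i₂ ⊛ ξₜ₂ i₂ i₄) ⊕ atom ⊛ ξₜ₁ i₄ ⊛ ξₜ₂ i₂ i₄

lemma6p6e : ∀ κ₁ {A} → Invariant A →
            let Λ = wt κ₁ 1 0 ; w = ⟦ wᵉ ⟧[ A ] ; w̄ = ⟦ w̄ᵉ ⟧[ A ] in
            dτ Λ (Ek i₁ i₃) w ≈ 𝟘 × dτ Λ (Ek i₂ i₄) w ≈ 𝕚 ·ₑ w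
            × τ Λ m₀ w ≈ w × τ Λ m₁ w ≈ w × τ Λ m₂ w ≈ neg w̄ × τ Λ m₃ w ≈ neg w̄
lemma6p6e κ₁ A-inv =
    dτ-by-normalForm Λ (Ek i₁ i₃) E₁₃-kills wᵉ (con 0i) refl
  & dτ-by-normalForm Λ (Ek i₂ i₄) E₂₄-kills wᵉ (con 𝕚 ⊛ wᵉ) refl
  & τ-by-normalForm Λ m₀ (m-fixes (# 0)) wᵉ wᵉ refl
  & τ-by-normalForm Λ m₁ (m-fixes (# 1)) wᵉ wᵉ refl
  & τ-by-normalForm Λ m₂ (m-fixes (# 2)) wᵉ (con -1i ⊛ w̄ᵉ) refl
  & τ-by-normalForm Λ m₃ (m-fixes (# 3)) wᵉ (con -1i ⊛ w̄ᵉ) refl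
  where
  open Invariant A-inv
  Λ : Weight
  Λ = wt κ₁ 1 0

Wᶠ : PT
Wᶠ = Ep i₁ i₂ ⊗ₜ atom ⊛ ξₜ₂ i₁ i₂ ⊞ₜ ⊟ₜ (Ep i₂ i₃ ⊗ₜ atom ⊛ ξₜ₂ i₂ i₃)
     ⊞ₜ Ep i₃ i₄ ⊗ₜ atom ⊛ ξₜ₂ i₃ i₄ ⊞ₜ Ep i₁ i₄ ⊗ₜ atom ⊛ ξₜ₂ i₁ i₄

lemma6p6f : ∀ κ₁ {A} → Invariant A →
            let Λ = wt κ₁ 1 0 ; w = ⟦ Wᶠ ⟧ₚ[ A ] in
            adτ Λ (Ek i₁ i₃) w ≈ₚ 𝟘ₚ × adτ Λ (Ek i₂ i₄) w ≈ₚ 𝟘ₚ × (∀ i → Adτ Λ (m i) w ≈ₚ w)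
lemma6p6f κ₁ A-inv =
    adτ-by-normalForms Λ (Ek i₁ i₃) E₁₃-kills Wᶠ 𝟘ₜ refl
  & adτ-by-normalForms Λ (Ek i₂ i₄) E₂₄-kills Wᶠ 𝟘ₜ refl
  & Adτ-m-by-normalForms Λ A-inv Wᶠ refl
  where
  open Invariant A-inv
  Λ : Weight
  Λ = wt κ₁ 1 0

lemma6p6 :
    -- (a) κ₁ even, (δ₂,δ₃) = (0,0)
    (∀ (κ₁ : ℕ) → 2 ≤ κ₁ → κ₁ % 2 ≡ 0 →
      dτ (wt κ₁ 0 0) (Ek i₁ i₃) (w₀ κ₁) ≈ 𝟘
      × dτ (wt κ₁ 0 0) (Ek i₂ i₄) (w₀ κ₁) ≈ 𝟘
      × (∀ (i : Fin 4) → τ (wt κ₁ 0 0) (m i) (w₀ κ₁) ≈ w₀ κ₁))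
    -- (b) κ₁ odd, (δ₂,δ₃) = (0,0);  w = w₂ + √-1 w₄,  w̄ = w₂ - √-1 w₄
    × (∀ (κ₁ : ℕ) → 2 ≤ κ₁ → κ₁ % 2 ≡ 1 →
      let w = w₁[ κ₁ ] i₂ ⊕ 𝕚 ·ₑ w₁[ κ₁ ] i₄
          w̄ = w₁[ κ₁ ] i₂ ⊖ 𝕚 ·ₑ w₁[ κ₁ ] i₄
      in dτ (wt κ₁ 0 0) (Ek i₁ i₃) w ≈ 𝟘
         × dτ (wt κ₁ 0 0) (Ek i₂ i₄) w ≈ 𝕚 ·ₑ w
         × τ (wt κ₁ 0 0) m₀ w ≈ w
         × τ (wt κ₁ 0 0) m₁ w ≈ w
         × τ (wt κ₁ 0 0) m₂ w ≈ neg w̄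
         × τ (wt κ₁ 0 0) m₃ w ≈ neg w̄)
    -- (c) κ₁ even, (δ₂,δ₃) = (1,1)
    × (∀ (κ₁ : ℕ) → 2 ≤ κ₁ → κ₁ % 2 ≡ 0 →
      let w = Ep i₁ i₂ ⊗ w[ κ₁ , i₃ ] i₄ ⊞ ⊟ (Ep i₂ i₃ ⊗ w[ κ₁ , i₁ ] i₄)
              ⊞ Ep i₃ i₄ ⊗ w[ κ₁ , i₁ ] i₂ ⊞ ⊟ (Ep i₁ i₄ ⊗ w[ κ₁ , i₂ ] i₃)
      in adτ (wt κ₁ 1 1) (Ek i₁ i₃) w ≈ₚ 𝟘ₚ
         × adτ (wt κ₁ 1 1) (Ek i₂ i₄) w ≈ₚ 𝟘ₚ
         × (∀ (i : Fin 4) → Adτ (wt κ₁ 1 1) (m i) w ≈ₚ w))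
    -- (d) κ₁ odd, (δ₂,δ₃) = (1,1)
    × (∀ (κ₁ : ℕ) → 2 ≤ κ₁ → κ₁ % 2 ≡ 1 →
      let w = ((-ₘ Ep i₃ i₄) +ₘ (𝕚 ·ₘ Ep i₂ i₃)) ⊗ w₁[ κ₁ ] i₁
              ⊞ (Ep i₁ i₄ +ₘ ((-ᵢ 𝕚) ·ₘ Ep i₁ i₂)) ⊗ w₁[ κ₁ ] i₃
          w̄ = ((-ₘ Ep i₃ i₄) +ₘ ((-ᵢ 𝕚) ·ₘ Ep i₂ i₃)) ⊗ w₁[ κ₁ ] i₁
              ⊞ (Ep i₁ i₄ +ₘ (𝕚 ·ₘ Ep i₁ i₂)) ⊗ w₁[ κ₁ ] i₃
      in adτ (wt κ₁ 1 1) (Ek i₁ i₃) w ≈ₚ 𝟘ₚ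
         × adτ (wt κ₁ 1 1) (Ek i₂ i₄) w ≈ₚ 𝕚 ·ₚ w
         × Adτ (wt κ₁ 1 1) m₀ w ≈ₚ w
         × Adτ (wt κ₁ 1 1) m₁ w ≈ₚ w
         × Adτ (wt κ₁ 1 1) m₂ w ≈ₚ ⊟ w̄
         × Adτ (wt κ₁ 1 1) m₃ w ≈ₚ ⊟ w̄)
    -- (e) κ₁ even, (δ₂,δ₃) = (1,0);  w = -√-1 w_{2,24} + w_{4,24}
    × (∀ (κ₁ : ℕ) → 2 ≤ κ₁ → κ₁ % 2 ≡ 0 →
      let w = (-ᵢ 𝕚) ·ₑ w[ κ₁ , i₂ , i₂ ] i₄ ⊕ w[ κ₁ , i₄ , i₂ ] i₄
          w̄ = 𝕚 ·ₑ w[ κ₁ , i₂ , i₂ ] i₄ ⊕ w[ κ₁ , i₄ , i₂ ] i₄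
      in dτ (wt κ₁ 1 0) (Ek i₁ i₃) w ≈ 𝟘
         × dτ (wt κ₁ 1 0) (Ek i₂ i₄) w ≈ 𝕚 ·ₑ w
         × τ (wt κ₁ 1 0) m₀ w ≈ w
         × τ (wt κ₁ 1 0) m₁ w ≈ w
         × τ (wt κ₁ 1 0) m₂ w ≈ neg w̄
         × τ (wt κ₁ 1 0) m₃ w ≈ neg w̄)
    -- (f) κ₁ odd, (δ₂,δ₃) = (1,0)
    × (∀ (κ₁ : ℕ) → 2 ≤ κ₁ → κ₁ % 2 ≡ 1 →
      let w = Ep i₁ i₂ ⊗ w₂[ κ₁ ] i₁ i₂ ⊞ ⊟ (Ep i₂ i₃ ⊗ w₂[ κ₁ ] i₂ i₃)
              ⊞ Ep i₃ i₄ ⊗ w₂[ κ₁ ] i₃ i₄ ⊞ Ep i₁ i₄ ⊗ w₂[ κ₁ ] i₁ i₄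
      in adτ (wt κ₁ 1 0) (Ek i₁ i₃) w ≈ₚ 𝟘ₚ
         × adτ (wt κ₁ 1 0) (Ek i₂ i₄) w ≈ₚ 𝟘ₚ
         × (∀ (i : Fin 4) → Adτ (wt κ₁ 1 0) (m i) w ≈ₚ w))
lemma6p6 =
    (λ κ₁ _ _ → lemma6p6a κ₁ (ξ-power (κ₁ / 2)))
  & (λ κ₁ _ _ → lemma6p6b κ₁ (ξ-power ((κ₁ ∸ 1) / 2)))
  & (λ κ₁ _ _ → lemma6p6c κ₁ (ξ-power ((κ₁ ∸ 2) / 2)))
  & (λ κ₁ _ _ → lemma6p6d κ₁ (ξ-power ((κ₁ ∸ 1) / 2)))
  & (λ κ₁ _ _ → lemma6p6e κ₁ (ξ-power ((κ₁ ∸ 2) / 2)))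
  & (λ κ₁ _ _ → lemma6p6f κ₁ (ξ-power ((κ₁ ∸ 1) / 2)))
  where
  ξ-power : ∀ n → Invariant (ξ ^ₑ n)
  ξ-power = ^ₑ-invariant ξ-invariant
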